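{- Let $n\ge1$, let $x_1,\dots,x_n$ be distinct integers greater than $1$, and let $D=\{1,x_1,\dots,x_n\}$. Then $\sigma(D)=2-n+\sum_{i=1}^n x_i$.
   Context: A signed tree is a pair $(T,s)$ with $T$ a finite tree and $s:E(T)\to\{+,-\}$. The signed degree $sdeg(v)$ of a vertex is the number of incident positive edges minus the number of incident negative edges. $(T,s)$ realizes $D$ if $D=\{sdeg(v):v\in V(T)\}$. For a set $D$ of integers containing $1$ or $-1$, $\sigma(D)$ is the minimum number of vertices of a tree $T$ such that some signed tree $(T,s)$ realizes $D$. -}

module Defs where

open import Data.Nat using (ℕ; suc; _≤_)
open import Data.Fin using (Fin; _≟_)
open import Data.Integer using (ℤ; +_; -_; _+_)
open import Data.Bool using (Bool; _∨_; if_then_else_)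
open import Data.List using (List; []; _∷_; _++_; length; foldr; map)
open import Data.List.Membership.Propositional using (_∈_)
open import Data.List.Relation.Unary.Any using (Any)
open import Data.List.Relation.Unary.All using (All)
open import Data.List.Relation.Unary.AllPairs using (AllPairs)
open import Data.List.Relation.Unary.Linked using (Linked)
open import Data.List.Relation.Unary.Unique.Propositional using (Unique)
open import Data.Product using (Σ; ∃; _×_; _,_)
open import Data.Sum using (_⊎_)
open import Relation.Nullary using (¬_; does)
open import Relation.Binary.PropositionalEquality using (_≡_; _≢_)
open import Relation.Binary.Construct.Closure.ReflexiveTransitive using (Star)

data Sign : Set where
  pos neg : Sign

record SEdge (m : ℕ) : Set where
  constructor sedge
  field
    u v  : Fin m
    sign : Sign
open SEdge public

module _ {m : ℕ} (E : List (SEdge m)) where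

  Joins : SEdge m → Fin m → Fin m → Set
  Joins e a b = (u e ≡ a × v e ≡ b) ⊎ (u e ≡ b × v e ≡ a)

  Adj : Fin m → Fin m → Set
  Adj a b = Any (λ e → Joins e a b) E

  SameEnds : SEdge m → SEdge m → Set
  SameEnds e f = Joins f (u e) (v e)

  Simple : Set
  Simple = All (λ e → u e ≢ v e) E × AllPairs (λ e f → ¬ SameEnds e f) E

  Connected : Set
  Connected = ∀ a b → Star Adj a b

  record Cycle : Set where
    field
      start   : Fin m
      rest    : List (Fin m)
      long    : 2 ≤ length rest
      distinct : Unique (start ∷ rest)
      walk    : Linked Adj (start ∷ (rest ++ start ∷ []))

  Acyclic : Set
  Acyclic = ¬ Cycle

  IsTree : Set
  IsTree = 1 ≤ m × Simple × Connected × Acyclic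

  signVal : Sign → ℤ
  signVal pos = + 1
  signVal neg = - (+ 1)

  contrib : Fin m → SEdge m → ℤ
  contrib x e = if does (u e ≟ x) ∨ does (v e ≟ x) then signVal (sign e) else + 0

  sdeg : Fin m → ℤ
  sdeg x = foldr _+_ (+ 0) (map (contrib x) E)

record SignedTree (m : ℕ) : Set where
  field
    edges  : List (SEdge m)
    isTree : IsTree edges
open SignedTree public

-- (T , s) realizes D, i.e. D = { sdeg v : v ∈ V(T) }  (D given as a list, read as a set)
Realizes : ∀ {m} → SignedTree m → List ℤ → Set
Realizes {m} T D =
  (∀ x → sdeg (edges T) x ∈ D) × (∀ d → d ∈ D → ∃ λ (x : Fin m) → sdeg (edges T) x ≡ d)

IsSigma : List ℤ → ℕ → Set
IsSigma D N =
  (Σ (SignedTree N) λ T → Realizes T D) ×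
  (∀ m (T : SignedTree m) → Realizes T D → N ≤ m)

sumℤ : List ℤ → ℤ
sumℤ = foldr _+_ (+ 0)

{-# OPTIONS --safe #-}
module Submission where

-- A tree on m vertices has m − 1 edges, and each edge adds ±1 to the signed degrees of its two
-- ends, so the signed degrees sum to at most 2m − 2. If (T , s) realizes {1, x₁, …, xₙ}, every
-- signed degree is at least 1 and the xᵢ sit at n distinct vertices, so the sum is at least
-- m − n + Σ xᵢ; hence m ≥ 2 − n + Σ xᵢ. The all-positive caterpillar whose spine vertices have
-- degrees x₁, …, xₙ attains the bound. It is grown leaf by leaf from a single edge, and its
-- acyclicity is certified by a 2-colouring separating the ends of each edge.

open import Defs
open import Data.Nat as ℕ using (ℕ; zero; suc; _≤_; z≤n; s≤s)
import Data.Nat.Properties as ℕP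
open import Data.Fin using (Fin; zero; suc; _≟_; _↑ˡ_; _↑ʳ_; splitAt)
open import Data.Fin.Properties
  using (suc-injective; ↑ʳ-injective; splitAt-↑ˡ; splitAt-↑ʳ; splitAt⁻¹-↑ˡ; splitAt⁻¹-↑ʳ)
open import Data.Bool using (Bool; true; false; _∨_; if_then_else_)
open import Data.Bool.Properties using (∨-identityʳ)
open import Data.Integer as ℤ using (ℤ; +_; -_; _+_; _-_; _<_)
import Data.Integer.Properties as ℤP
open import Data.Integer.Tactic.RingSolver using (solve-∀)
open import Algebra.Properties.CommutativeMonoid.Sum ℤP.+-0-commutativeMonoid
  using (sum; ∑-distrib-+; sum-replicate-zero; sum-cong-≗)
open import Data.Vec.Functional using (updateAt)
open import Data.Vec.Functional.Properties using (updateAt-updates; updateAt-minimal)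
open import Data.List using (List; []; _∷_; _++_; length; map)
open import Data.List.Properties using (map-cong-local; length-map)
open import Data.List.Membership.Propositional using (_∈_)
import Data.List.Membership.DecPropositional as DecMembership
open import Data.List.Relation.Unary.Any as Any using (Any; here; there)
import Data.List.Relation.Unary.Any.Properties as AnyP
open import Data.List.Relation.Unary.All as All using (All; []; _∷_)
import Data.List.Relation.Unary.All.Properties as AllP
open import Data.List.Relation.Unary.All.Properties using (¬Any⇒All¬; All¬⇒¬Any)
import Data.List.Relation.Unary.AllPairs as AllPairs
open import Data.List.Relation.Unary.AllPairs using ([]; _∷_)
import Data.List.Relation.Unary.AllPairs.Properties as AllPairsP
open import Data.List.Relation.Unary.Linked as Linked using (Linked; [-]; _∷_)
open import Data.List.Relation.Unary.Unique.Propositional using (Unique)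
open import Data.List.Relation.Unary.Unique.Propositional.Properties using (map⁻)
open import Data.Product using (Σ; ∃; _×_; _,_; proj₁; proj₂)
open import Data.Sum as Sum using (_⊎_; inj₁; inj₂)
open import Data.Empty using (⊥; ⊥-elim)
open import Function using (_∘_)
open import Relation.Nullary using (¬_; yes; no; does)
open import Relation.Nullary.Decidable using (dec-true; dec-false)
open import Relation.Binary.PropositionalEquality
  using (_≡_; _≢_; refl; sym; trans; cong; cong₂; subst; subst₂; ≢-sym)
open import Relation.Binary.Construct.Closure.ReflexiveTransitive
  using (Star; ε; _◅_; _◅◅_; reverse)

module _ {m : ℕ} {R : Fin m → Fin m → Set} where

  -- all vertices of the walk except its endpoint
  vertices : ∀ {a c} → Star R a c → List (Fin m)
  vertices ε = []
  vertices (_◅_ {a} _ w) = a ∷ vertices w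

  Unrepeated : ∀ {a c} → Star R a c → Set
  Unrepeated {c = c} w = Unique (c ∷ vertices w)

  suffix : ∀ {a b c} (w : Star R b c) → a ∈ vertices w → Unrepeated w → Σ (Star R a c) Unrepeated
  suffix (r ◅ w) (here refl) u = r ◅ w , u
  suffix (r ◅ w) (there a∈w) ((_ ∷ c∉w) ∷ (_ ∷ uw)) = suffix w a∈w (c∉w ∷ uw)

  unrepeated : ∀ {a c} → Star R a c → Σ (Star R a c) Unrepeated
  unrepeated ε = ε , [] ∷ []
  unrepeated {a} {c} (r ◅ s) with unrepeated s
  ... | w , u@(c∉w ∷ uw) with a ≟ c
  ...   | yes refl = ε , [] ∷ []
  ...   | no a≢c with DecMembership._∈?_ _≟_ a (vertices w)
  ...     | yes a∈w = suffix w a∈w u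
  ...     | no a∉w = r ◅ w , (≢-sym a≢c ∷ c∉w) ∷ (¬Any⇒All¬ _ a∉w ∷ uw)

  linked : ∀ {a c} (w : Star R a c) → Linked R (vertices w ++ c ∷ [])
  linked ε = [-]
  linked (r ◅ ε) = r ∷ [-]
  linked (r ◅ w@(_ ◅ _)) = r ∷ linked w

module _ {m : ℕ} {E : List (SEdge m)} where

  joins-sym : ∀ {e a b} → Joins E e a b → Joins E e b a
  joins-sym (inj₁ (p , q)) = inj₂ (p , q)
  joins-sym (inj₂ (p , q)) = inj₁ (p , q)

  adj-sym : ∀ {a b} → Adj E a b → Adj E b a
  adj-sym = Any.map (λ {e} → joins-sym {e})

  path-sym : ∀ {a b} → Star (Adj E) a b → Star (Adj E) b a
  path-sym = reverse adj-sym

module _ {m : ℕ} {e : SEdge m} {E : List (SEdge m)} where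

  path-weaken : ∀ {a b} → Star (Adj E) a b → Star (Adj (e ∷ E)) a b
  path-weaken ε = ε
  path-weaken (r ◅ s) = there r ◅ path-weaken s

  simple-tail : Simple (e ∷ E) → Simple E
  simple-tail (_ ∷ loopless , _ ∷ unparallel) = loopless , unparallel

  acyclic-tail : Acyclic (e ∷ E) → Acyclic E
  acyclic-tail acyclic c = acyclic record
    { start = Cycle.start c ; rest = Cycle.rest c ; long = Cycle.long c
    ; distinct = Cycle.distinct c ; walk = Linked.map there (Cycle.walk c) }

  -- An unrepeated path from v e back to u e would close a cycle through e.
  no-bypass : Simple (e ∷ E) → Acyclic (e ∷ E) → ¬ Star (Adj E) (v e) (u e)
  no-bypass (nonloop ∷ _ , unparallel ∷ _) acyclic path = closes (proj₂ (unrepeated path)) refl refl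
    where
    closes : ∀ {a b} {w : Star (Adj E) a b} → Unrepeated w → a ≡ v e → b ≡ u e → ⊥
    closes {w = ε} _ refl b≡u = nonloop (sym b≡u)
    closes {w = r ◅ ε} _ refl refl = All¬⇒¬Any unparallel (adj-sym r)
    closes {w = w@(_ ◅ _ ◅ _)} distinct refl refl = acyclic record
      { start = u e ; rest = vertices w ; long = s≤s (s≤s z≤n) ; distinct = distinct
      ; walk = here (inj₁ (refl , refl)) ∷ Linked.map there (linked w) }

-- Forests

count : ∀ {m} → (Fin m → Bool) → ℕ
count {zero} p = 0
count {suc m} p = (if p zero then 1 else 0) ℕ.+ count (p ∘ suc)

count-all : ∀ {m} (p : Fin m → Bool) → (∀ x → p x ≡ true) → count p ≡ m
count-all {zero} p all = refl
count-all {suc m} p all rewrite all zero = cong suc (count-all (p ∘ suc) (all ∘ suc))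

count-pos : ∀ {m} (p : Fin m → Bool) (a : Fin m) → p a ≡ true → 1 ≤ count p
count-pos p zero pa rewrite pa = s≤s z≤n
count-pos p (suc a) pa with p zero
... | true = s≤s z≤n
... | false = count-pos (p ∘ suc) a pa

count-cong : ∀ {m} (p q : Fin m → Bool) → (∀ x → p x ≡ q x) → count p ≡ count q
count-cong {zero} p q p≗q = refl
count-cong {suc m} p q p≗q rewrite p≗q zero =
  cong (_ ℕ.+_) (count-cong (p ∘ suc) (q ∘ suc) (p≗q ∘ suc))

count-drop : ∀ {m} (p q : Fin m → Bool) (a : Fin m) → p a ≡ true → q a ≡ false →
             (∀ x → x ≢ a → q x ≡ p x) → count p ≡ suc (count q)
count-drop p q zero pa qa agree rewrite pa | qa =
  cong suc (count-cong (p ∘ suc) (q ∘ suc) (λ x → sym (agree (suc x) λ ())))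
count-drop p q (suc a) pa qa agree rewrite agree zero (λ ()) with p zero
... | true = cong suc (count-drop (p ∘ suc) (q ∘ suc) a pa qa λ x x≢a → agree (suc x) (x≢a ∘ suc-injective))
... | false = count-drop (p ∘ suc) (q ∘ suc) a pa qa λ x x≢a → agree (suc x) (x≢a ∘ suc-injective)

isRoot : ∀ {m} → (Fin m → Fin m) → Fin m → Bool
isRoot root x = does (root x ≟ x)

record Components {m : ℕ} (E : List (SEdge m)) : Set where
  field
    root : Fin m → Fin m
    root-idem : ∀ x → root (root x) ≡ root x
    root-path : ∀ x → Star (Adj E) x (root x)
    roots+edges : count (isRoot root) ℕ.+ length E ≡ m

discrete : ∀ {m} → Components {m} []
discrete = record
  { root = λ x → x ; root-idem = λ _ → refl ; root-path = λ _ → ε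
  ; roots+edges = trans (ℕP.+-identityʳ _) (count-all _ λ x → dec-true (x ≟ x) refl) }

-- Joining the components of u e and v e by e keeps roots + edges constant.
module Merge {m : ℕ} {e : SEdge m} {E : List (SEdge m)} (C : Components E)
             (U≢V : Components.root C (u e) ≢ Components.root C (v e)) where
  open Components C

  U V : Fin m
  U = root (u e)
  V = root (v e)

  root′ : Fin m → Fin m
  root′ x with root x ≟ V
  ... | yes _ = U
  ... | no _ = root x

  root′-idem : ∀ x → root′ (root′ x) ≡ root′ x
  root′-idem x with root x ≟ V
  ... | yes _ with root U ≟ V
  ...   | yes rU≡V = ⊥-elim (U≢V (trans (sym (root-idem (u e))) rU≡V))
  ...   | no _ = root-idem (u e)
  root′-idem x | no rx≢V with root (root x) ≟ V
  ...   | yes rrx≡V = ⊥-elim (rx≢V (trans (sym (root-idem x)) rrx≡V))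
  ...   | no _ = root-idem x

  root′-path : ∀ x → Star (Adj (e ∷ E)) x (root′ x)
  root′-path x with root x ≟ V
  ... | yes rx≡V =
    path-weaken (root-path x ◅◅ subst (λ z → Star (Adj E) z (v e)) (sym rx≡V) (path-sym (root-path (v e))))
    ◅◅ (here (inj₂ (refl , refl)) ◅ path-weaken (root-path (u e)))
  ... | no _ = path-weaken (root-path x)

  V-root : isRoot root V ≡ true
  V-root = dec-true (root V ≟ V) (root-idem (v e))

  V-not-root′ : isRoot root′ V ≡ false
  V-not-root′ with root V ≟ V
  ... | yes _ = dec-false (U ≟ V) U≢V
  ... | no rV≢V = ⊥-elim (rV≢V (root-idem (v e)))

  roots-elsewhere : ∀ x → x ≢ V → isRoot root′ x ≡ isRoot root x
  roots-elsewhere x x≢V with root x ≟ V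
  ... | yes rx≡V = trans
    (dec-false (U ≟ x) λ U≡x → U≢V (trans (sym (root-idem (u e))) (trans (cong root U≡x) rx≡V)))
    (sym (dec-false (root x ≟ x) λ rx≡x → x≢V (trans (sym rx≡x) rx≡V)))
  ... | no _ = refl

  roots′+edges : count (isRoot root′) ℕ.+ suc (length E) ≡ m
  roots′+edges = trans (ℕP.+-suc _ _) (trans
    (cong (ℕ._+ length E) (sym (count-drop (isRoot root) (isRoot root′) V V-root V-not-root′ roots-elsewhere)))
    roots+edges)

  merge : Components (e ∷ E)
  merge = record
    { root = root′ ; root-idem = root′-idem ; root-path = root′-path ; roots+edges = roots′+edges }

forest-components : ∀ {m} (E : List (SEdge m)) → Simple E → Acyclic E → Components E
forest-components [] _ _ = discrete
forest-components (e ∷ E) simple acyclic =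
  Merge.merge C λ U≡V → no-bypass simple acyclic
    (root-path (v e) ◅◅ subst (λ z → Star (Adj E) z (u e)) U≡V (path-sym (root-path (u e))))
  where
  C : Components E
  C = forest-components E (simple-tail simple) (acyclic-tail acyclic)
  open Components C

forest-size : ∀ {m} (E : List (SEdge m)) → 1 ≤ m → Simple E → Acyclic E → suc (length E) ≤ m
forest-size {suc m} E _ simple acyclic = subst (suc (length E) ≤_) roots+edges
  (ℕP.+-monoˡ-≤ (length E) (count-pos (isRoot root) (root zero) root-is-root))
  where
  open Components (forest-components E simple acyclic)
  root-is-root : isRoot root (root zero) ≡ true
  root-is-root = dec-true (root (root zero) ≟ root zero) (root-idem zero)

-- Degree sums

sum-point : ∀ {m} (s : ℤ) (a : Fin m) → sum (λ x → if does (a ≟ x) then s else + 0) ≡ s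
sum-point {suc m} s zero = trans (cong (_+_ s) (sum-replicate-zero m)) (ℤP.+-identityʳ s)
sum-point {suc m} s (suc a) = trans (ℤP.+-identityˡ _) (sum-point s a)

sum-pair : ∀ {m} (s : ℤ) (a b : Fin m) → a ≢ b →
           sum (λ x → if does (a ≟ x) ∨ does (b ≟ x) then s else + 0) ≡ s + s
sum-pair s zero zero a≢b = ⊥-elim (a≢b refl)
sum-pair s zero (suc b) _ = cong (_+_ s) (sum-point s b)
sum-pair s (suc a) zero _ =
  cong (_+_ s) (trans (sum-cong-≗ λ x → cong (λ b → if b then s else + 0) (∨-identityʳ (does (a ≟ x))))
                      (sum-point s a))
sum-pair s (suc a) (suc b) a≢b = trans (ℤP.+-identityˡ _) (sum-pair s a b (a≢b ∘ cong suc))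

sum-sumℤ-comm : ∀ {m} {A : Set} (f : Fin m → A → ℤ) (l : List A) →
  sum (λ x → sumℤ (map (f x) l)) ≡ sumℤ (map (λ a → sum (λ x → f x a)) l)
sum-sumℤ-comm {m} f [] = sum-replicate-zero m
sum-sumℤ-comm f (a ∷ l) =
  trans (∑-distrib-+ (λ x → f x a) (λ x → sumℤ (map (f x) l)))
        (cong (_+_ (sum (λ x → f x a))) (sum-sumℤ-comm f l))

module _ {m : ℕ} (E : List (SEdge m)) where

  sum-contrib : ∀ e → u e ≢ v e → sum (λ x → contrib E x e) ≡ signVal E (sign e) + signVal E (sign e)
  sum-contrib e = sum-pair (signVal E (sign e)) (u e) (v e)

  signVal-twice≤2 : ∀ s → signVal E s + signVal E s ℤ.≤ + 2
  signVal-twice≤2 pos = ℤP.≤-refl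
  signVal-twice≤2 neg = ℤ.-≤+

  sum-contribs≤ : ∀ l → All (λ e → u e ≢ v e) l →
    sumℤ (map (λ e → sum (λ x → contrib E x e)) l) ℤ.≤ + length l + + length l
  sum-contribs≤ [] [] = ℤP.≤-refl
  sum-contribs≤ (e ∷ l) (nonloop ∷ nonloops) =
    subst (sum (λ x → contrib E x e) + sumℤ (map (λ e → sum (λ x → contrib E x e)) l) ℤ.≤_)
          (regroup (+ length l))
      (ℤP.+-mono-≤ (subst (ℤ._≤ + 2) (sym (sum-contrib e nonloop)) (signVal-twice≤2 (sign e)))
                   (sum-contribs≤ l nonloops))
    where
    regroup : ∀ n → + 2 + (n + n) ≡ (+ 1 + n) + (+ 1 + n)
    regroup = solve-∀

degree-sum≤ : ∀ {m} (E : List (SEdge m)) → All (λ e → u e ≢ v e) E →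
              sum (sdeg E) ℤ.≤ + length E + + length E
degree-sum≤ E nonloops =
  subst (ℤ._≤ + length E + + length E) (sym (sum-sumℤ-comm (contrib E) E)) (sum-contribs≤ E E nonloops)

sum-nonneg : ∀ {m} (g : Fin m → ℤ) → (∀ x → + 0 ℤ.≤ g x) → + 0 ℤ.≤ sum g
sum-nonneg {zero} g g≥0 = ℤP.≤-refl
sum-nonneg {suc m} g g≥0 = ℤP.+-mono-≤ (g≥0 zero) (sum-nonneg (g ∘ suc) (g≥0 ∘ suc))

erase : ∀ {m} → (Fin m → ℤ) → Fin m → Fin m → ℤ
erase g a = updateAt g a (λ _ → + 0)

sum-erase : ∀ {m} (g : Fin m → ℤ) (a : Fin m) → sum g ≡ g a + sum (erase g a)
sum-erase g zero = cong (_+_ (g zero)) (sym (ℤP.+-identityˡ _))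
sum-erase g (suc a) = trans (cong (_+_ (g zero)) (sum-erase (g ∘ suc) a)) (swap (g zero) (g (suc a)) _)
  where
  swap : ∀ x y z → x + (y + z) ≡ y + (x + z)
  swap = solve-∀

erase-nonneg : ∀ {m} (g : Fin m → ℤ) (a : Fin m) → (∀ x → + 0 ℤ.≤ g x) → ∀ x → + 0 ℤ.≤ erase g a x
erase-nonneg g a g≥0 x with x ≟ a
... | yes refl = subst (+ 0 ℤ.≤_) (sym (updateAt-updates a g)) ℤP.≤-refl
... | no x≢a = subst (+ 0 ℤ.≤_) (sym (updateAt-minimal x a g x≢a)) (g≥0 x)

sumℤ-map≤sum : ∀ {m} (g : Fin m → ℤ) (L : List (Fin m)) → (∀ x → + 0 ℤ.≤ g x) → Unique L →
               sumℤ (map g L) ℤ.≤ sum g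
sumℤ-map≤sum g [] g≥0 [] = sum-nonneg g g≥0
sumℤ-map≤sum g (a ∷ L) g≥0 (a∉L ∷ unique) =
  subst (g a + sumℤ (map g L) ℤ.≤_) (sym (sum-erase g a))
    (ℤP.+-monoʳ-≤ (g a)
      (subst (ℤ._≤ sum (erase g a)) (cong sumℤ (map-cong-local erase-elsewhere))
        (sumℤ-map≤sum (erase g a) L (erase-nonneg g a g≥0) unique)))
  where
  erase-elsewhere : All (λ x → erase g a x ≡ g x) L
  erase-elsewhere = All.map (λ a≢x → updateAt-minimal _ a g (≢-sym a≢x)) a∉L

pred-step : ∀ x s k → (x - + 1) + (s - k) ≡ (x + s) - (+ 1 + k)
pred-step = solve-∀

sum-pred : ∀ {m} (f : Fin m → ℤ) → sum (λ x → f x - + 1) ≡ sum f - + m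
sum-pred {zero} f = refl
sum-pred {suc m} f = trans (cong (_+_ (f zero - + 1)) (sum-pred (f ∘ suc))) (pred-step (f zero) _ (+ m))

sumℤ-map-pred : ∀ {A : Set} (f : A → ℤ) (L : List A) →
                sumℤ (map (λ x → f x - + 1) L) ≡ sumℤ (map f L) - + length L
sumℤ-map-pred f [] = refl
sumℤ-map-pred f (x ∷ L) =
  trans (cong (_+_ (f x - + 1)) (sumℤ-map-pred f L)) (pred-step (f x) _ (+ length L))

preimages : ∀ {A B : Set} (f : A → B) (ys : List B) → All (λ y → ∃ λ x → f x ≡ y) ys →
            ∃ λ xs → map f xs ≡ ys
preimages f [] [] = [] , refl
preimages f (y ∷ ys) ((x , fx≡y) ∷ hits) with preimages f ys hits
... | xs , map≡ = x ∷ xs , cong₂ _∷_ fx≡y map≡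

distinct-values≤sum : ∀ {m} (f : Fin m → ℤ) (ys : List ℤ) → (∀ x → + 1 ℤ.≤ f x) → Unique ys →
  All (λ y → ∃ λ x → f x ≡ y) ys → sumℤ ys - + length ys ℤ.≤ sum f - + m
distinct-values≤sum {m} f ys f≥1 unique hits with preimages f ys hits
... | L , map≡ = begin
  sumℤ ys - + length ys    ≡⟨ sym sum-over-L ⟩
  sumℤ (map f-1 L)         ≤⟨ sumℤ-map≤sum f-1 L (λ x → ℤP.+-monoˡ-≤ (- + 1) (f≥1 x)) L-unique ⟩
  sum f-1                  ≡⟨ sum-pred f ⟩
  sum f - + m              ∎
  where
  open ℤP.≤-Reasoning
  f-1 : Fin m → ℤ
  f-1 x = f x - + 1
  L-unique : Unique L
  L-unique = map⁻ (subst Unique (sym map≡) unique)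
  sum-over-L : sumℤ (map f-1 L) ≡ sumℤ ys - + length ys
  sum-over-L = trans (sumℤ-map-pred f L)
    (cong₂ (λ s n → s - + n) (cong sumℤ map≡) (trans (sym (length-map f L)) (cong length map≡)))

tree-degree-sum≤ : ∀ {m} {E : List (SEdge m)} → IsTree E → sum (sdeg E) - + m ℤ.≤ + m - + 2
tree-degree-sum≤ {m} {E} (nonempty , simple@(nonloops , _) , _ , acyclic) = begin
  sum (sdeg E) - + m                ≤⟨ ℤP.+-monoˡ-≤ (- + m) (degree-sum≤ E nonloops) ⟩
  (+ e + + e) - + m                 ≡⟨ regroup (+ e) (+ m) ⟩
  ((+ 1 + + e) + (+ 1 + + e)) - + m - + 2
                                    ≤⟨ ℤP.+-monoˡ-≤ (- + 2) (ℤP.+-monoˡ-≤ (- + m) (ℤP.+-mono-≤ e<m e<m)) ⟩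
  (+ m + + m) - + m - + 2           ≡⟨ cancel (+ m) ⟩
  + m - + 2                         ∎
  where
  open ℤP.≤-Reasoning
  e : ℕ
  e = length E
  e<m : + suc e ℤ.≤ + m
  e<m = ℤ.+≤+ (forest-size E nonempty simple acyclic)
  regroup : ∀ k n → (k + k) - n ≡ ((+ 1 + k) + (+ 1 + k)) - n - + 2
  regroup = solve-∀
  cancel : ∀ n → (n + n) - n - + 2 ≡ n - + 2
  cancel = solve-∀

realization-order≥ : ∀ {m} (T : SignedTree m) (xs : List ℤ) → Unique xs → All (+ 1 <_) xs →
  Realizes T (+ 1 ∷ xs) → (+ 2 - + length xs) + sumℤ xs ℤ.≤ + m
realization-order≥ {m} T xs unique >1 (degrees-in , attained) =
  subst₂ ℤ._≤_ (rearrange (sumℤ xs) (+ length xs)) (rearrange′ (+ m))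
    (ℤP.+-monoˡ-≤ (+ 2) (ℤP.≤-trans
      (distinct-values≤sum (sdeg (edges T)) xs deg≥1 unique (All.tabulate λ x∈xs → attained _ (there x∈xs)))
      (tree-degree-sum≤ (isTree T))))
  where
  deg≥1 : ∀ x → + 1 ℤ.≤ sdeg (edges T) x
  deg≥1 x = All.lookup (ℤP.≤-refl ∷ All.map ℤP.<⇒≤ >1) (degrees-in x)
  rearrange : ∀ s n → (s - n) + + 2 ≡ (+ 2 - n) + s
  rearrange = solve-∀
  rearrange′ : ∀ k → (k - + 2) + + 2 ≡ k
  rearrange′ = solve-∀

-- Caterpillars

module _ {m : ℕ} (E : List (SEdge m)) where

  Separates : Fin m → Fin m → (Fin m → Bool) → Set
  Separates p q c = c p ≢ c q × (∀ x y → Adj E x y → c x ≡ c y ⊎ (x ≡ p × y ≡ q) ⊎ (x ≡ q × y ≡ p))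

  AllBridges : Set
  AllBridges = ∀ p q → Adj E p q → ∃ (Separates p q)

module _ {m : ℕ} {E : List (SEdge m)} where

  separates-sym : ∀ {p q c} → Separates E p q c → Separates E q p c
  separates-sym (cp≢cq , along) = ≢-sym cp≢cq , λ x y r → swap (along x y r)
    where
    swap : ∀ {A B C : Set} → A ⊎ B ⊎ C → A ⊎ C ⊎ B
    swap (inj₁ a) = inj₁ a
    swap (inj₂ (inj₁ b)) = inj₂ (inj₂ b)
    swap (inj₂ (inj₂ c)) = inj₂ (inj₁ c)

  module _ {p q : Fin m} {c : Fin m → Bool} (sep : Separates E p q c) where

    colour-step : ∀ {x y} → Adj E x y → x ≢ p → x ≢ q → c x ≡ c y
    colour-step {x} {y} r x≢p x≢q with proj₂ sep x y r
    ... | inj₁ cx≡cy = cx≡cy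
    ... | inj₂ (inj₁ (x≡p , _)) = ⊥-elim (x≢p x≡p)
    ... | inj₂ (inj₂ (x≡q , _)) = ⊥-elim (x≢q x≡q)

    colour-constant : ∀ y l z → All (λ w → w ≢ p × w ≢ q) (y ∷ l) →
                      Linked (Adj E) (y ∷ l ++ z ∷ []) → c y ≡ c z
    colour-constant y [] z ((y≢p , y≢q) ∷ []) (r ∷ [-]) = colour-step r y≢p y≢q
    colour-constant y (w ∷ l) z ((y≢p , y≢q) ∷ avoid) (r ∷ walk) =
      trans (colour-step r y≢p y≢q) (colour-constant w l z avoid walk)

  -- The bridge a — w₁ of a cycle a, w₁, w₂, …, a is bypassed by the rest of the cycle.
  bridges⇒acyclic : AllBridges E → Acyclic E
  bridges⇒acyclic bridges record { rest = [] ; long = () }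
  bridges⇒acyclic bridges record { rest = _ ∷ [] ; long = s≤s () }
  bridges⇒acyclic bridges record
    { start = a ; rest = w₁ ∷ w₂ ∷ ws
    ; distinct = (_ ∷ a∉ws) ∷ w₁∉ws ∷ _ ; walk = r₁ ∷ r₂ ∷ walk } with bridges a w₁ r₁
  ... | _ , sep = proj₁ sep (trans (sym (colour-constant sep w₂ ws a avoid walk))
                                   (colour-step sep (adj-sym r₂) w₂≢a w₂≢w₁))
    where
    avoid : All (λ w → w ≢ a × w ≢ w₁) (w₂ ∷ ws)
    avoid = All.zip (All.map ≢-sym a∉ws , All.map ≢-sym w₁∉ws)
    w₂≢a : w₂ ≢ a
    w₂≢a = proj₁ (All.head avoid)
    w₂≢w₁ : w₂ ≢ w₁
    w₂≢w₁ = proj₂ (All.head avoid)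

lift : ∀ {m} → SEdge m → SEdge (suc m)
lift e = sedge (suc (u e)) (suc (v e)) (sign e)

-- The new leaf is vertex zero; the old vertex x becomes suc x.
module AttachLeaf {m : ℕ} (E : List (SEdge m)) (a : Fin m) where

  E′ : List (SEdge (suc m))
  E′ = sedge zero (suc a) pos ∷ map lift E

  joins-lift : ∀ {f x y} → Joins E f x y → Joins E′ (lift f) (suc x) (suc y)
  joins-lift (inj₁ (p , q)) = inj₁ (cong suc p , cong suc q)
  joins-lift (inj₂ (p , q)) = inj₂ (cong suc p , cong suc q)

  joins-unlift : ∀ {f x y} → Joins E′ (lift f) (suc x) (suc y) → Joins E f x y
  joins-unlift (inj₁ (p , q)) = inj₁ (suc-injective p , suc-injective q)
  joins-unlift (inj₂ (p , q)) = inj₂ (suc-injective p , suc-injective q)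

  lifted-avoid-zero : ∀ {y} l → ¬ Any (λ f → Joins E′ f zero y) (map lift l)
  lifted-avoid-zero (g ∷ l) (here (inj₁ (() , _)))
  lifted-avoid-zero (g ∷ l) (here (inj₂ (_ , ())))
  lifted-avoid-zero (g ∷ l) (there k) = lifted-avoid-zero l k

  adj-lift : ∀ {x y} → Adj E x y → Adj E′ (suc x) (suc y)
  adj-lift r = there (AnyP.map⁺ (Any.map (λ {f} → joins-lift {f}) r))

  adj-unlift : ∀ {x y} → Adj E′ (suc x) (suc y) → Adj E x y
  adj-unlift (here (inj₁ (() , _)))
  adj-unlift (here (inj₂ (() , _)))
  adj-unlift (there k) = Any.map (λ {f} → joins-unlift {f}) (AnyP.map⁻ k)

  adj-zero : ∀ {y} → Adj E′ zero y → y ≡ suc a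
  adj-zero (here (inj₁ (_ , q))) = sym q
  adj-zero (here (inj₂ (_ , ())))
  adj-zero (there k) = ⊥-elim (lifted-avoid-zero E k)

  simple′ : Simple E → Simple E′
  simple′ (nonloops , unparallel) =
    ((λ ()) ∷ AllP.map⁺ (All.map (λ u≢v → u≢v ∘ suc-injective) nonloops)) ,
    (¬Any⇒All¬ _ (lifted-avoid-zero E) ∷
     AllPairsP.map⁺ (AllPairs.map (λ {_} {f} ¬same → ¬same ∘ joins-unlift {f}) unparallel))

  path-lift : ∀ {x y} → Star (Adj E) x y → Star (Adj E′) (suc x) (suc y)
  path-lift ε = ε
  path-lift (r ◅ s) = adj-lift r ◅ path-lift s

  connected′ : Connected E → Connected E′
  connected′ connected x y = path-sym (to-leaf x) ◅◅ to-leaf y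
    where
    to-leaf : ∀ x → Star (Adj E′) zero x
    to-leaf zero = ε
    to-leaf (suc x) = here (inj₁ (refl , refl)) ◅ path-lift (connected a x)

  isLeaf : Fin (suc m) → Bool
  isLeaf zero = true
  isLeaf (suc _) = false

  leaf-separates : Separates E′ zero (suc a) isLeaf
  leaf-separates = (λ ()) , along
    where
    along : ∀ x y → Adj E′ x y → isLeaf x ≡ isLeaf y ⊎ (x ≡ zero × y ≡ suc a) ⊎ (x ≡ suc a × y ≡ zero)
    along zero zero r with adj-zero r
    ... | ()
    along zero (suc y) r = inj₂ (inj₁ (refl , adj-zero r))
    along (suc x) zero r = inj₂ (inj₂ (adj-zero (adj-sym r) , refl))
    along (suc x) (suc y) r = inj₁ refl

  liftColouring : (Fin m → Bool) → Fin (suc m) → Bool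
  liftColouring c zero = c a
  liftColouring c (suc x) = c x

  separates-lift : ∀ {p q c} → Separates E p q c → Separates E′ (suc p) (suc q) (liftColouring c)
  separates-lift {p} {q} {c} (cp≢cq , along) = cp≢cq , along′
    where
    along′ : ∀ x y → Adj E′ x y →
      liftColouring c x ≡ liftColouring c y ⊎ (x ≡ suc p × y ≡ suc q) ⊎ (x ≡ suc q × y ≡ suc p)
    along′ zero zero r with adj-zero r
    ... | ()
    along′ zero (suc y) r = inj₁ (cong c (sym (suc-injective (adj-zero r))))
    along′ (suc x) zero r = inj₁ (cong c (suc-injective (adj-zero (adj-sym r))))
    along′ (suc x) (suc y) r with along x y (adj-unlift r)
    ... | inj₁ cx≡cy = inj₁ cx≡cy
    ... | inj₂ (inj₁ (x≡p , y≡q)) = inj₂ (inj₁ (cong suc x≡p , cong suc y≡q))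
    ... | inj₂ (inj₂ (x≡q , y≡p)) = inj₂ (inj₂ (cong suc x≡q , cong suc y≡p))

  bridges′ : AllBridges E → AllBridges E′
  bridges′ bridges zero q r rewrite adj-zero r = isLeaf , leaf-separates
  bridges′ bridges (suc p) zero r rewrite suc-injective (adj-zero (adj-sym r)) =
    isLeaf , separates-sym leaf-separates
  bridges′ bridges (suc p) (suc q) r with bridges p q (adj-unlift r)
  ... | c , separates = liftColouring c , separates-lift separates

  lifted-contribs-zero : ∀ l → sumℤ (map (contrib E′ zero) (map lift l)) ≡ + 0
  lifted-contribs-zero [] = refl
  lifted-contribs-zero (f ∷ l) rewrite lifted-contribs-zero l = refl

  lifted-contribs : ∀ x l → map (contrib E′ (suc x)) (map lift l) ≡ map (contrib E x) l
  lifted-contribs x [] = refl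
  lifted-contribs x (f ∷ l) = cong (contrib E x f ∷_) (lifted-contribs x l)

  sdeg-leaf : sdeg E′ zero ≡ + 1
  sdeg-leaf rewrite lifted-contribs-zero E = refl

  sdeg-centre : sdeg E′ (suc a) ≡ + 1 + sdeg E a
  sdeg-centre rewrite lifted-contribs a E | dec-true (a ≟ a) refl = refl

  sdeg-other : ∀ x → x ≢ a → sdeg E′ (suc x) ≡ sdeg E x
  sdeg-other x x≢a rewrite lifted-contribs x E | dec-false (a ≟ x) (≢-sym x≢a) = ℤP.+-identityˡ (sdeg E x)

record BridgedTree (m : ℕ) : Set where
  field
    treeEdges : List (SEdge m)
    simple : Simple treeEdges
    connected : Connected treeEdges
    bridges : AllBridges treeEdges

degree : ∀ {m} → BridgedTree m → Fin m → ℤ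
degree T = sdeg (BridgedTree.treeEdges T)

Attained : ∀ {m} → BridgedTree m → ℤ → Set
Attained T d = ∃ λ x → degree T x ≡ d

AttainedAwayFrom : ∀ {m} → BridgedTree m → Fin m → ℤ → Set
AttainedAwayFrom T a d = ∃ λ x → x ≢ a × degree T x ≡ d

toSignedTree : ∀ {m} → BridgedTree m → Fin m → SignedTree m
toSignedTree T x = record
  { edges = treeEdges
  ; isTree = nonempty x , simple , connected , bridges⇒acyclic bridges }
  where
  open BridgedTree T
  nonempty : ∀ {n} → Fin n → 1 ≤ n
  nonempty zero = s≤s z≤n
  nonempty (suc _) = s≤s z≤n

singleVertex : BridgedTree 1
singleVertex = record
  { treeEdges = [] ; simple = [] , [] ; connected = λ { zero zero → ε } ; bridges = λ _ _ () }

attachLeaf : ∀ {m} → BridgedTree m → Fin m → BridgedTree (suc m)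
attachLeaf T a = record
  { treeEdges = E′ ; simple = simple′ simple
  ; connected = connected′ connected ; bridges = bridges′ bridges }
  where
  open BridgedTree T
  open AttachLeaf treeEdges a

-- The new leaves are the vertices i ↑ˡ m; the old vertex x becomes k ↑ʳ x.
attachLeaves : ∀ {m} (k : ℕ) → BridgedTree m → Fin m → BridgedTree (k ℕ.+ m)
attachLeaves zero T a = T
attachLeaves (suc k) T a = attachLeaf (attachLeaves k T a) (k ↑ʳ a)

module _ {m : ℕ} (T : BridgedTree m) (a : Fin m) where
  open BridgedTree

  degree-centre : ∀ k → degree (attachLeaves k T a) (k ↑ʳ a) ≡ + k + degree T a
  degree-centre zero = sym (ℤP.+-identityˡ (degree T a))
  degree-centre (suc k) = trans (AttachLeaf.sdeg-centre (treeEdges (attachLeaves k T a)) (k ↑ʳ a))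
    (trans (cong (_+_ (+ 1)) (degree-centre k)) (sym (ℤP.+-assoc (+ 1) (+ k) (degree T a))))

  degree-kept : ∀ k x → x ≢ a → degree (attachLeaves k T a) (k ↑ʳ x) ≡ degree T x
  degree-kept zero x x≢a = refl
  degree-kept (suc k) x x≢a = trans
    (AttachLeaf.sdeg-other (treeEdges (attachLeaves k T a)) (k ↑ʳ a) (k ↑ʳ x) (x≢a ∘ ↑ʳ-injective k x a))
    (degree-kept k x x≢a)

  degree-new : ∀ k (i : Fin k) → degree (attachLeaves k T a) (i ↑ˡ m) ≡ + 1
  degree-new (suc k) zero = AttachLeaf.sdeg-leaf (treeEdges (attachLeaves k T a)) (k ↑ʳ a)
  degree-new (suc k) (suc i) = trans
    (AttachLeaf.sdeg-other (treeEdges (attachLeaves k T a)) (k ↑ʳ a) (i ↑ˡ m) (↑ˡ≢↑ʳ i a))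
    (degree-new k i)
    where
    ↑ˡ≢↑ʳ : ∀ {k} (i : Fin k) (x : Fin m) → i ↑ˡ m ≢ k ↑ʳ x
    ↑ˡ≢↑ʳ {k} i x eq with trans (sym (splitAt-↑ˡ k i m)) (trans (cong (splitAt k) eq) (splitAt-↑ʳ k m x))
    ... | ()

  degree-attachLeaves : ∀ k z → let d = degree (attachLeaves k T a) z in
    d ≡ + 1 ⊎ d ≡ + k + degree T a ⊎ AttainedAwayFrom T a d
  degree-attachLeaves k z with splitAt k z in eq
  ... | inj₁ i rewrite sym (splitAt⁻¹-↑ˡ eq) = inj₁ (degree-new k i)
  ... | inj₂ x with x ≟ a
  ...   | yes refl rewrite sym (splitAt⁻¹-↑ʳ eq) = inj₂ (inj₁ (degree-centre k))
  ...   | no x≢a rewrite sym (splitAt⁻¹-↑ʳ eq) = inj₂ (inj₂ (x , x≢a , sym (degree-kept k x x≢a)))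

-- The caterpillar grown from the leaf a, whose new spine vertices get the degrees xs in turn.
record Extension {m : ℕ} (T : BridgedTree m) (a : Fin m) (xs : List ℤ) : Set where
  field
    size : ℕ
    tree : BridgedTree size
    size≡ : + size ≡ + m + (sumℤ xs - + length xs)
    degrees : ∀ y → degree tree y ≡ + 1 ⊎ degree tree y ∈ xs ⊎ AttainedAwayFrom T a (degree tree y)
    keeps : ∀ {d} → AttainedAwayFrom T a d → Attained tree d
    attains : All (Attained tree) xs

extend : ∀ {m} (T : BridgedTree m) (a : Fin m) → degree T a ≡ + 1 →
         ∀ x xs → All (+ 1 <_) (x ∷ xs) → Extension T a (x ∷ xs)
extend {m} T a deg-a (+ suc (suc j)) xs (ℤ.+<+ (s≤s (s≤s _)) ∷ >1) = extension xs >1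
  where
  k : ℕ
  k = suc j
  T₁ : BridgedTree (k ℕ.+ m)
  T₁ = attachLeaves k T a

  centre-degree : + k + degree T a ≡ + suc k
  centre-degree = trans (cong (_+_ (+ k)) deg-a) (cong (λ n → + suc n) (ℕP.+-comm j 1))

  centre : AttainedAwayFrom T₁ zero (+ suc k)
  centre = k ↑ʳ a , (λ ()) , trans (degree-centre T a k) centre-degree

  kept : ∀ {d} → AttainedAwayFrom T a d → AttainedAwayFrom T₁ zero d
  kept (x , x≢a , eq) = k ↑ʳ x , (λ ()) , trans (degree-kept T a k x x≢a) eq

  degrees₁ : ∀ z → let d = degree T₁ z in d ≡ + 1 ⊎ d ≡ + suc k ⊎ AttainedAwayFrom T a d
  degrees₁ z with degree-attachLeaves T a k z
  ... | inj₁ leaf = inj₁ leaf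
  ... | inj₂ (inj₁ at-centre) = inj₂ (inj₁ (trans at-centre centre-degree))
  ... | inj₂ (inj₂ other) = inj₂ (inj₂ other)

  forget : ∀ {d} → AttainedAwayFrom T₁ zero d → Attained T₁ d
  forget (x , _ , eq) = x , eq

  extension : ∀ xs → All (+ 1 <_) xs → Extension T a (+ suc k ∷ xs)
  extension [] [] = record
    { size = k ℕ.+ m ; tree = T₁ ; size≡ = count-single (+ j) (+ m)
    ; degrees = λ y → Sum.map₂ (Sum.map₁ here) (degrees₁ y)
    ; keeps = λ other → forget (kept other) ; attains = forget centre ∷ [] }
    where
    count-single : ∀ J M → (+ 1 + J) + M ≡ M + (((+ 2 + J) + + 0) - + 1)
    count-single = solve-∀
  extension (x′ ∷ xs′) >1′ = record
    { size = size ; tree = tree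
    ; size≡ = trans size≡ (count-cons (+ j) (+ m) (sumℤ (x′ ∷ xs′)) (+ length (x′ ∷ xs′)))
    ; degrees = degrees′ ; keeps = λ other → keeps (kept other) ; attains = keeps centre ∷ attains }
    where
    open Extension (extend T₁ zero (degree-new T a k zero) x′ xs′ >1′)
    count-cons : ∀ J M S L → ((+ 1 + J) + M) + (S - L) ≡ M + (((+ 2 + J) + S) - (+ 1 + L))
    count-cons = solve-∀
    degrees′ : ∀ y → degree tree y ≡ + 1 ⊎ degree tree y ∈ (+ suc k ∷ x′ ∷ xs′)
                     ⊎ AttainedAwayFrom T a (degree tree y)
    degrees′ y with degrees y
    ... | inj₁ leaf = inj₁ leaf
    ... | inj₂ (inj₁ listed) = inj₂ (inj₁ (there listed))
    ... | inj₂ (inj₂ (z , _ , eq)) with degrees₁ z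
    ...   | inj₁ leaf = inj₁ (trans (sym eq) leaf)
    ...   | inj₂ (inj₁ at-centre) = inj₂ (inj₁ (here (trans (sym eq) at-centre)))
    ...   | inj₂ (inj₂ other) = inj₂ (inj₂ (subst (AttainedAwayFrom T a) eq other))

caterpillar : ∀ x xs → All (+ 1 <_) (x ∷ xs) →
  Σ ℕ λ N → Σ (SignedTree N) (λ T → Realizes T (+ 1 ∷ x ∷ xs))
          × + N ≡ (+ 2 - + length (x ∷ xs)) + sumℤ (x ∷ xs)
caterpillar x xs >1 = size , (toSignedTree tree (proj₁ one) , degrees-in , attained) , size-formula
  where
  edge : BridgedTree 2
  edge = attachLeaf singleVertex zero
  open Extension (extend edge (suc zero) refl x xs >1)
  one : Attained tree (+ 1)
  one = keeps (zero , (λ ()) , refl)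
  degrees-in : ∀ y → degree tree y ∈ (+ 1 ∷ x ∷ xs)
  degrees-in y with degrees y
  ... | inj₁ leaf = here leaf
  ... | inj₂ (inj₁ listed) = there listed
  ... | inj₂ (inj₂ (zero , _ , eq)) = here (sym eq)
  ... | inj₂ (inj₂ (suc zero , 1≢1 , _)) = ⊥-elim (1≢1 refl)
  attained : ∀ d → d ∈ (+ 1 ∷ x ∷ xs) → Attained tree d
  attained d (here refl) = one
  attained d (there listed) = All.lookup attains listed
  size-formula : + size ≡ (+ 2 - + length (x ∷ xs)) + sumℤ (x ∷ xs)
  size-formula = trans size≡ (rearrange (sumℤ (x ∷ xs)) (+ length (x ∷ xs)))
    where
    rearrange : ∀ s n → + 2 + (s - n) ≡ (+ 2 - n) + s
    rearrange = solve-∀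

mainTheorem7 : (xs : List ℤ) → 1 ≤ length xs → Unique xs → All (λ x → + 1 < x) xs →
    Σ ℕ (λ N → IsSigma (+ 1 ∷ xs) N × + N ≡ (+ 2 - + length xs) + sumℤ xs)
mainTheorem7 [] () _ _
mainTheorem7 (x ∷ xs) _ unique >1 with caterpillar x xs >1
... | N , realization , N≡ = N , (realization , minimal) , N≡
  where
  minimal : ∀ m (T : SignedTree m) → Realizes T (+ 1 ∷ x ∷ xs) → N ≤ m
  minimal m T realizes =
    ℤP.drop‿+≤+ (subst (ℤ._≤ + m) (sym N≡) (realization-order≥ T (x ∷ xs) unique >1 realizes))
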